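{- Let $A$ be an alphabet with at least two letters. Among the bidimensional words $w\colon\mathbb{N}^2\to A$ obtainable by the following construction, there are uncountably many which are not morphic. Construction: Step 0: pick $a\in A$ and set $w(2i,2j)=a$ for all $(i,j)\in\mathbb{N}^2$. Step 1: choose arbitrary letters at positions $(0,1),(1,0),(1,1)$, and set $w(4i,4j+1)=w(0,1)$, $w(4i+1,4j)=w(1,0)$, $w(4i+1,4j+1)=w(1,1)$ for all $(i,j)$. Step $n\ge 2$: let $S$ be the set of pairs $(k,\ell)$ with $k,\ell<2^{n+1}$ not yet filled; fill the positions of $S$ with arbitrary letters, and for every $(k,\ell)\in\mathbb{N}^2$ and $(k',\ell')\in S$ set $w(2^{n+2}k+k',2^{n+2}\ell+\ell')=w(k',\ell')$.
   Context: $\mathbb{N}=\{0,1,\ldots\}$. A bidimensional morphism of constant size $(s_1,s_2)$ maps each letter to a block over $\{0,\ldots,s_1-1\}\times\{0,\ldots,s_2-1\}$; a pure morphic word is the fixed point $\lim_n\varphi^n(a)$ of such a morphism $\varphi$ prolongable on $a$ (i.e. $\varphi(a)_{(0,0)}=a$), and a morphic word is the image of a pure morphic word under a letter-to-letter map. In particular there are only countably many morphic words. -}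

module Defs where

open import Data.Nat using (ℕ; zero; suc; _+_; _*_; _^_; _<_; _≤_; NonZero)
open import Data.Nat.Properties using (m^n≢0)
open import Data.Nat.DivMod using (_%_; _/_; _mod_)
open import Data.Fin using (Fin)
open import Data.Product using (Σ; Σ-syntax; _×_; ∃)
open import Data.Sum using (_⊎_)
open import Data.Empty using (⊥)
open import Relation.Nullary using (¬_)
open import Relation.Binary.PropositionalEquality using (_≡_)

Word : Set → Set
Word A = ℕ → ℕ → A

-- The construction of Proposition 7.2.
-- Step n fills the set S n of positions (x,y) with x,y < region n that
-- are not filled at steps m < n, and then repeats them with period
-- `period n`:
--   step 0 : region 1            (S 0 = {(0,0)}),       period 2
--   step 1 : region 2            (S 1 = {(0,1),(1,0),(1,1)}), period 4
--   step n ≥ 2 : region 2^(n+1),                        period 2^(n+2)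

region : ℕ → ℕ
region zero = 1
region (suc zero) = 2
region (suc (suc n)) = 2 ^ (3 + n)

period : ℕ → ℕ
period zero = 2
period (suc zero) = 4
period (suc (suc n)) = 2 ^ (4 + n)

period-nonZero : ∀ n → NonZero (period n)
period-nonZero zero = _
period-nonZero (suc zero) = _
period-nonZero (suc (suc n)) = m^n≢0 2 (4 + n)

mutual
  FilledBefore : ℕ → ℕ → ℕ → Set
  FilledBefore zero x y = ⊥
  FilledBefore (suc n) x y =
    FilledBefore n x y ⊎ InS n ((x % period n) {{period-nonZero n}}) ((y % period n) {{period-nonZero n}})

  InS : ℕ → ℕ → ℕ → Set
  InS n x y = x < region n × y < region n × ¬ FilledBefore n x y

Constructible : {A : Set} → Word A → Set
Constructible w =
  ∀ n k' l' → InS n k' l' → ∀ k l →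
    w (period n * k + k') (period n * l + l') ≡ w k' l'

Morphism : ℕ → ℕ → ℕ → Set
Morphism m t₁ t₂ = Fin m → Fin (2 + t₁) → Fin (2 + t₂) → Fin m

-- iterate n φ a = φⁿ(a), a block of size (2+t₁)ⁿ × (2+t₂)ⁿ, read at (i,j)
-- (values outside the block are irrelevant).
iterate : ∀ {m t₁ t₂} → Morphism m t₁ t₂ → ℕ → Fin m → Word (Fin m)
iterate φ zero a i j = a
iterate {t₁ = t₁} {t₂} φ (suc n) a i j =
  φ (iterate φ n a (i / (2 + t₁)) (j / (2 + t₂))) (i mod (2 + t₁)) (j mod (2 + t₂))

Prolongable : ∀ {m t₁ t₂} → Morphism m t₁ t₂ → Fin m → Set
Prolongable φ a = φ a Fin.zero Fin.zero ≡ a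

IsLimit : ∀ {m t₁ t₂} → Morphism m t₁ t₂ → Fin m → Word (Fin m) → Set
IsLimit {t₁ = t₁} {t₂} φ a x =
  ∀ n i j → i < (2 + t₁) ^ n → j < (2 + t₂) ^ n → x i j ≡ iterate φ n a i j

IsPureMorphic : ∀ {m} → Word (Fin m) → Set
IsPureMorphic {m} x =
  Σ[ t₁ ∈ ℕ ] Σ[ t₂ ∈ ℕ ] Σ[ φ ∈ Morphism m t₁ t₂ ] Σ[ a ∈ Fin m ]
    Prolongable φ a × IsLimit φ a x

IsMorphic : {A : Set} → Word A → Set
IsMorphic {A} w =
  Σ[ m ∈ ℕ ] Σ[ x ∈ Word (Fin m) ] Σ[ τ ∈ (Fin m → A) ]
    IsPureMorphic x × (∀ i j → w i j ≡ τ (x i j))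

-- The free choices of the construction are spent diagonally. The point
-- x = region (2 + n) − 1 lies, modulo the period of every earlier step, outside
-- that step's region, so the positions (x, 0) and (x, 1) are still free at step
-- 2 + n; they receive letters different from those of the n-th given word f n
-- and of the n-th word of an enumeration of all morphic words. Such an
-- enumeration exists because a pure morphic word satisfies x i j = φ^(i+j)(a) i j,
-- so a morphic word is determined by finitely many natural numbers: the alphabet
-- and block sizes, φ, a and the letter-to-letter map.
module Submission where

open import Defs
open import Data.Nat using (ℕ; _≤_)
open import Data.Fin using (Fin)
open import Data.Product using (Σ-syntax; _×_; ∃)
open import Relation.Nullary using (¬_)
open import Relation.Binary.PropositionalEquality using (_≢_)

open import Data.Nat using (zero; suc; pred; _+_; _*_; _^_; _∸_; _<_; _<?_; _≤?_; z≤n; s≤s; NonZero)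
open import Data.Nat.Properties
open import Data.Nat.DivMod using (_%_; _/_; _mod_; m<n⇒m%n≡m; %-pred-≡0; %-remove-+ˡ)
open import Data.Nat.Divisibility using (_∣_; m∣m*n; ∣m⇒∣m*n; n∣m⇒m%n≡0)
open import Data.Fin using (zero; suc; toℕ; #_; punchIn)
open import Data.Fin.Properties using (toℕ<n; toℕ-fromℕ<; toℕ-injective; punchInᵢ≢i)
open import Data.Product using (_,_; proj₁; proj₂)
open import Data.Sum using (inj₁; inj₂)
open import Data.Empty using (⊥-elim)
open import Function using (_∘_)
open import Relation.Nullary using (Dec; yes; no; ¬?)
open import Relation.Nullary.Decidable using (_⊎-dec_; _×-dec_)
open import Relation.Binary.PropositionalEquality
  using (_≡_; refl; sym; trans; cong; cong₂; subst; subst₂; module ≡-Reasoning)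

n<m^n : ∀ {m} → 1 < m → ∀ n → n < m ^ n
n<m^n {m@(suc _)} 1<m zero = s≤s z≤n
n<m^n {m@(suc _)} 1<m (suc n) = begin-strict
  suc n     ≤⟨ n<m^n 1<m n ⟩
  m ^ n     <⟨ m<m*n (m ^ n) m {{m^n≢0 m n}} 1<m ⟩
  m ^ n * m ≡⟨ *-comm (m ^ n) m ⟩
  m ^ suc n ∎
  where open ≤-Reasoning

^-monoʳ-∣ : ∀ m {a b} → a ≤ b → m ^ a ∣ m ^ b
^-monoʳ-∣ m {a} a≤b with k , refl ← m≤n⇒∃[o]m+o≡n a≤b =
  subst (m ^ a ∣_) (sym (^-distribˡ-+-* m a k)) (m∣m*n (m ^ k))

regionExp : ℕ → ℕ
regionExp zero = 0
regionExp (suc zero) = 1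
regionExp (suc (suc n)) = 3 + n

region≡2^regionExp : ∀ n → region n ≡ 2 ^ regionExp n
region≡2^regionExp zero = refl
region≡2^regionExp (suc zero) = refl
region≡2^regionExp (suc (suc n)) = refl

period≡2^[1+regionExp] : ∀ n → period n ≡ 2 ^ suc (regionExp n)
period≡2^[1+regionExp] zero = refl
period≡2^[1+regionExp] (suc zero) = refl
period≡2^[1+regionExp] (suc (suc n)) = refl

region-nonZero : ∀ n → NonZero (region n)
region-nonZero n = subst NonZero (sym (region≡2^regionExp n)) (m^n≢0 2 (regionExp n))

regionExp-<-suc : ∀ n → regionExp n < regionExp (suc n)
regionExp-<-suc zero = s≤s z≤n
regionExp-<-suc (suc zero) = s≤s (s≤s z≤n)
regionExp-<-suc (suc (suc n)) = n<1+n (3 + n)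

regionExp-mono-< : ∀ {m n} → m < n → regionExp m < regionExp n
regionExp-mono-< {m} {suc n} m<1+n with m<1+n⇒m<n∨m≡n m<1+n
... | inj₁ m<n = <-trans (regionExp-mono-< m<n) (regionExp-<-suc n)
... | inj₂ refl = regionExp-<-suc m

regionExp-mono-≤ : ∀ {m n} → m ≤ n → regionExp m ≤ regionExp n
regionExp-mono-≤ m≤n with m≤n⇒m<n∨m≡n m≤n
... | inj₁ m<n = <⇒≤ (regionExp-mono-< m<n)
... | inj₂ refl = ≤-refl

n≤regionExp : ∀ n → n ≤ regionExp n
n≤regionExp zero = z≤n
n≤regionExp (suc zero) = ≤-refl
n≤regionExp (suc (suc n)) = n≤1+n (2 + n)

n<region : ∀ n → n < region n
n<region n = subst (n <_) (sym (region≡2^regionExp n))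
  (≤-<-trans (n≤regionExp n) (n<m^n (s≤s (s≤s z≤n)) (regionExp n)))

region<period : ∀ n → region n < period n
region<period n = subst₂ _<_ (sym (region≡2^regionExp n)) (sym (period≡2^[1+regionExp] n))
  (^-monoʳ-< 2 (s≤s (s≤s z≤n)) (n<1+n (regionExp n)))

region≤period∸1 : ∀ n → region n ≤ period n ∸ 1
region≤period∸1 n = subst (region n ≤_) (pred[m∸n]≡m∸[1+n] (period n) 0) (<⇒≤pred (region<period n))

period-mono-∣ : ∀ {m n} → m ≤ n → period m ∣ period n
period-mono-∣ {m} {n} m≤n = subst₂ _∣_ (sym (period≡2^[1+regionExp] m)) (sym (period≡2^[1+regionExp] n))
  (^-monoʳ-∣ 2 (s≤s (regionExp-mono-≤ m≤n)))

period∣region : ∀ {m n} → m < n → period m ∣ region n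
period∣region {m} {n} m<n = subst₂ _∣_ (sym (period≡2^[1+regionExp] m)) (sym (region≡2^regionExp n))
  (^-monoʳ-∣ 2 (regionExp-mono-< m<n))

infixl 7 _%P_
_%P_ : ℕ → ℕ → ℕ
x %P n = (x % period n) {{period-nonZero n}}

%P-id : ∀ {n x} → x < region n → x %P n ≡ x
%P-id {n} x<region = m<n⇒m%n≡m {{period-nonZero n}}
  (<-trans x<region (region<period n))

%P-periodic : ∀ {m n} → m ≤ n → ∀ k x → (period n * k + x) %P m ≡ x %P m
%P-periodic {m} m≤n k x = %-remove-+ˡ x {{period-nonZero m}} (∣m⇒∣m*n k (period-mono-∣ m≤n))

edge : ℕ → ℕ
edge n = pred (region (2 + n))

edge<region : ∀ n → edge n < region (2 + n)
edge<region n = subst (edge n <_) (suc-pred (region (2 + n)) {{region-nonZero (2 + n)}}) (n<1+n (edge n))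

edge%P : ∀ {m n} → m < 2 + n → edge n %P m ≡ period m ∸ 1
edge%P {m} {n} m<2+n = %-pred-≡0 {{period-nonZero m}} (begin
  suc (edge n) %P m    ≡⟨ cong (_%P m) (suc-pred (region (2 + n)) {{region-nonZero (2 + n)}}) ⟩
  region (2 + n) %P m  ≡⟨ n∣m⇒m%n≡0 _ _ {{period-nonZero m}} (period∣region m<2+n) ⟩
  0                    ∎)
  where open ≡-Reasoning

FilledBefore? : ∀ n x y → Dec (FilledBefore n x y)
FilledBefore? zero x y = no λ ()
FilledBefore? (suc n) x y = FilledBefore? n x y ⊎-dec
  (x %P n <? region n ×-dec y %P n <? region n ×-dec ¬? (FilledBefore? n (x %P n) (y %P n)))

FilledBefore-mono : ∀ {m n x y} → m ≤ n → FilledBefore m x y → FilledBefore n x y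
FilledBefore-mono {n = zero} z≤n ()
FilledBefore-mono {m} {suc n} m≤1+n filled with m≤n⇒m<n∨m≡n m≤1+n
... | inj₁ (s≤s m≤n) = inj₁ (FilledBefore-mono m≤n filled)
... | inj₂ refl = filled

FilledBefore-cong : ∀ {n x y x′ y′} →
  (∀ {m} → m < n → x %P m ≡ x′ %P m) → (∀ {m} → m < n → y %P m ≡ y′ %P m) →
  FilledBefore n x y → FilledBefore n x′ y′
FilledBefore-cong {suc n} x≡ y≡ (inj₁ filled) = inj₁ (FilledBefore-cong (x≡ ∘ m<n⇒m<1+n) (y≡ ∘ m<n⇒m<1+n) filled)
FilledBefore-cong {suc n} x≡ y≡ (inj₂ new) = inj₂ (subst₂ (InS n) (x≡ (n<1+n n)) (y≡ (n<1+n n)) new)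

filledBy : ∀ {n x y} → x < region n → y < region n → FilledBefore (suc n) x y
filledBy {n} {x} {y} x<region y<region with FilledBefore? n x y
... | yes filled = inj₁ filled
... | no new = inj₂ (subst₂ (InS n) (sym (%P-id {n} x<region)) (sym (%P-id {n} y<region)) (x<region , y<region , new))

beyondRegions⇒¬FilledBefore : ∀ {n x y} → (∀ {m} → m < n → region m ≤ x %P m) → ¬ FilledBefore n x y
beyondRegions⇒¬FilledBefore {suc n} beyond (inj₁ filled) = beyondRegions⇒¬FilledBefore (beyond ∘ m<n⇒m<1+n) filled
beyondRegions⇒¬FilledBefore {suc n} beyond (inj₂ (x<region , _)) = <⇒≱ x<region (beyond (n<1+n n))

edge-InS : ∀ n {y} → y < region (2 + n) → InS (2 + n) (edge n) y
edge-InS n y<region = edge<region n , y<region , beyondRegions⇒¬FilledBefore λ {m} m<2+n →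
  subst (region m ≤_) (sym (edge%P m<2+n)) (region≤period∸1 m)

module Filling {A : Set} (L : ℕ → ℕ → ℕ → A) where

  -- The value at zero is junk: it is never reached from a position filled before n.
  firstLetter : ℕ → ℕ → ℕ → A
  firstLetter zero x y = L zero x y
  firstLetter (suc n) x y with FilledBefore? n x y
  ... | yes _ = firstLetter n x y
  ... | no _ = L n (x %P n) (y %P n)

  fill : Word A
  fill x y = firstLetter (suc (x + y)) x y

  firstLetter-first : ∀ {s n x y} → ¬ FilledBefore s x y → InS s (x %P s) (y %P s) → s < n →
    firstLetter n x y ≡ L s (x %P s) (y %P s)
  firstLetter-first {s} {suc n} {x} {y} new ins (s≤s s≤n) with FilledBefore? n x y | m≤n⇒m<n∨m≡n s≤n
  ... | yes _      | inj₁ s<n = firstLetter-first new ins s<n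
  ... | yes filled | inj₂ refl = ⊥-elim (new filled)
  ... | no new′    | inj₁ s<n = ⊥-elim (new′ (FilledBefore-mono s<n (inj₂ ins)))
  ... | no _       | inj₂ refl = refl

  fill-first : ∀ {s x y} → ¬ FilledBefore s x y → InS s (x %P s) (y %P s) →
    fill x y ≡ L s (x %P s) (y %P s)
  fill-first {s} {x} {y} new ins with s ≤? x + y
  ... | yes s≤x+y = firstLetter-first new ins (s≤s s≤x+y)
  ... | no s≰x+y = ⊥-elim (new (FilledBefore-mono (≰⇒> s≰x+y) (filledBy {x + y} x<region y<region)))
    where
    x<region : x < region (x + y)
    x<region = ≤-<-trans (m≤m+n x y) (n<region (x + y))
    y<region : y < region (x + y)
    y<region = ≤-<-trans (m≤n+m y x) (n<region (x + y))

  fill-periodic : ∀ {s x y x′ y′} →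
    (∀ {m} → m ≤ s → x %P m ≡ x′ %P m) → (∀ {m} → m ≤ s → y %P m ≡ y′ %P m) →
    InS s x′ y′ → fill x y ≡ L s x′ y′
  fill-periodic {s} {x} {y} {x′} {y′} x≡ y≡ ins@(x′<region , y′<region , new′) =
    begin
      fill x y                 ≡⟨ fill-first new (subst₂ (InS s) (sym x%s) (sym y%s) ins) ⟩
      L s (x %P s) (y %P s)    ≡⟨ cong₂ (L s) x%s y%s ⟩
      L s x′ y′                ∎
    where
    open ≡-Reasoning
    x%s : x %P s ≡ x′
    x%s = trans (x≡ ≤-refl) (%P-id {s} x′<region)
    y%s : y %P s ≡ y′
    y%s = trans (y≡ ≤-refl) (%P-id {s} y′<region)
    new : ¬ FilledBefore s x y
    new = new′ ∘ FilledBefore-cong (x≡ ∘ <⇒≤) (y≡ ∘ <⇒≤)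

  fill-InS : ∀ {s x y} → InS s x y → fill x y ≡ L s x y
  fill-InS = fill-periodic (λ _ → refl) (λ _ → refl)

  fill-constructible : Constructible fill
  fill-constructible n k′ l′ ins k l =
    trans (fill-periodic (λ m≤n → %P-periodic m≤n k k′) (λ m≤n → %P-periodic m≤n l l′) ins)
          (sym (fill-InS ins))

next : ℕ × ℕ → ℕ × ℕ
next (zero , b) = suc b , zero
next (suc a , b) = a , suc b

unpair : ℕ → ℕ × ℕ
unpair zero = 0 , 0
unpair (suc n) = next (unpair n)

Reached : ℕ × ℕ → Set
Reached p = ∃ λ n → unpair n ≡ p

reached-next : ∀ {p} → Reached p → Reached (next p)
reached-next (n , unpair≡p) = suc n , cong next unpair≡p

reached-antidiagonal : ∀ b a → Reached (a + b , 0) → Reached (a , b)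
reached-antidiagonal zero a reached = subst (λ c → Reached (c , 0)) (+-identityʳ a) reached
reached-antidiagonal (suc b) a reached =
  reached-next (reached-antidiagonal b (suc a) (subst (λ c → Reached (c , 0)) (+-suc a b) reached))

reached-axis : ∀ s → Reached (s , 0)
reached-axis zero = 0 , refl
reached-axis (suc s) = reached-next (reached-antidiagonal s 0 (reached-axis s))

unpair-surjective : ∀ p → Reached p
unpair-surjective (a , b) = reached-antidiagonal b a (reached-axis (a + b))

decode : ℕ → ℕ → ℕ
decode c zero = proj₁ (unpair c)
decode c (suc i) = decode (proj₂ (unpair c)) i

decode-choice : ∀ N (P : Fin N → ℕ → Set) → (∀ i → ∃ (P i)) → ∃ λ c → ∀ i → P i (decode c (toℕ i))
decode-choice zero P choice = 0 , λ ()
decode-choice (suc N) P choice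
  with c , tail ← decode-choice N (P ∘ suc) (choice ∘ suc)
  with c₀ , head ← choice zero
  with n , unpair≡ ← unpair-surjective (c₀ , c) = n , entries
  where
  entries : ∀ i → P i (decode n (toℕ i))
  entries zero rewrite unpair≡ = head
  entries (suc i) rewrite unpair≡ = tail i

toℕ-mod : ∀ {k} (i : Fin (suc k)) → toℕ i mod suc k ≡ i
toℕ-mod i = toℕ-injective (trans (toℕ-fromℕ< _) (m<n⇒m%n≡m (toℕ<n i)))

decodeFin : ∀ {N k} → ℕ → Fin N → Fin (suc k)
decodeFin {k = k} c i = decode c (toℕ i) mod suc k

decodeFin-surjective : ∀ {N k} (g : Fin N → Fin (suc k)) → ∃ λ c → ∀ i → decodeFin c i ≡ g i
decodeFin-surjective {N} {k} g = decode-choice N (λ i n → n mod suc k ≡ g i) λ i → toℕ (g i) , toℕ-mod (g i)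

decodeMorphism : ∀ {m t₁ t₂} → ℕ → Morphism (suc m) t₁ t₂
decodeMorphism c p i = decodeFin (decode (decode c (toℕ p)) (toℕ i))

decodeMorphism-surjective : ∀ {m t₁ t₂} (φ : Morphism (suc m) t₁ t₂) →
  ∃ λ c → ∀ p i j → decodeMorphism c p i j ≡ φ p i j
decodeMorphism-surjective {m} {t₁} {t₂} φ =
  decode-choice (suc m) (λ p c → ∀ i j → decodeFin (decode c (toℕ i)) j ≡ φ p i j) λ p →
  decode-choice (2 + t₁) (λ i c → ∀ j → decodeFin c j ≡ φ p i j) λ i →
  decodeFin-surjective (φ p i)

iterate-cong : ∀ {m t₁ t₂} {φ ψ : Morphism m t₁ t₂} → (∀ p i j → φ p i j ≡ ψ p i j) →
  ∀ n a i j → iterate φ n a i j ≡ iterate ψ n a i j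
iterate-cong φ≗ψ zero a i j = refl
iterate-cong {t₁ = t₁} {t₂} φ≗ψ (suc n) a i j
  rewrite iterate-cong φ≗ψ n a (i / (2 + t₁)) (j / (2 + t₂)) = φ≗ψ _ _ _

limit-at-diagonal : ∀ {m t₁ t₂} {φ : Morphism m t₁ t₂} {a x} → IsLimit φ a x →
  ∀ i j → x i j ≡ iterate φ (i + j) a i j
limit-at-diagonal lim i j = lim (i + j) i j
  (≤-<-trans (m≤m+n i j) (n<m^n (s≤s (s≤s z≤n)) (i + j)))
  (≤-<-trans (m≤n+m j i) (n<m^n (s≤s (s≤s z≤n)) (i + j)))

morphicWord : ∀ {k} (m t₁ t₂ a φ τ : ℕ) → Word (Fin (suc k))
morphicWord m t₁ t₂ a φ τ i j =
  decodeFin τ (iterate (decodeMorphism {m} {t₁} {t₂} φ) (i + j) (a mod suc m) i j)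

morphicWord-limit : ∀ {k m t₁ t₂ a φ τ} {φ′ : Morphism (suc m) t₁ t₂} {a′ x} {τ′ : Fin (suc m) → Fin (suc k)} →
  a mod suc m ≡ a′ → (∀ p i j → decodeMorphism φ p i j ≡ φ′ p i j) → (∀ p → decodeFin τ p ≡ τ′ p) →
  IsLimit φ′ a′ x → ∀ i j → morphicWord m t₁ t₂ a φ τ i j ≡ τ′ (x i j)
morphicWord-limit {φ = φ} {τ} {φ′} {x = x} {τ′} refl φ≗φ′ τ≗τ′ lim i j = begin
  decodeFin τ (iterate (decodeMorphism φ) (i + j) _ i j) ≡⟨ τ≗τ′ _ ⟩
  τ′ (iterate (decodeMorphism φ) (i + j) _ i j)         ≡⟨ cong τ′ (iterate-cong φ≗φ′ (i + j) _ i j) ⟩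
  τ′ (iterate φ′ (i + j) _ i j)                         ≡⟨ cong τ′ (limit-at-diagonal lim i j) ⟨
  τ′ (x i j)                                            ∎
  where open ≡-Reasoning

enumMorphic : ∀ {k} → ℕ → Word (Fin (suc k))
enumMorphic c = morphicWord (decode c 0) (decode c 1) (decode c 2) (decode c 3) (decode c 4) (decode c 5)

enumMorphic-decode : ∀ {k} c {m t₁ t₂} → decode c 0 ≡ m → decode c 1 ≡ t₁ → decode c 2 ≡ t₂ →
  ∀ i j → enumMorphic {k} c i j ≡ morphicWord m t₁ t₂ (decode c 3) (decode c 4) (decode c 5) i j
enumMorphic-decode c refl refl refl i j = refl

enumMorphic-complete : ∀ {k} {w : Word (Fin (suc k))} → IsMorphic w → ∃ λ c → ∀ i j → w i j ≡ enumMorphic c i j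
enumMorphic-complete (zero , _ , _ , (_ , _ , _ , () , _) , _)
enumMorphic-complete (suc m , x , τ , (t₁ , t₂ , φ , a , _ , lim) , w≡τx) =
  c , λ i j → trans (w≡τx i j) (sym (trans (shape i j) (limit i j)))
  where
  code : Fin 6 → ℕ → Set
  code zero n = n ≡ m
  code (suc zero) n = n ≡ t₁
  code (suc (suc zero)) n = n ≡ t₂
  code (suc (suc (suc zero))) n = n mod suc m ≡ a
  code (suc (suc (suc (suc zero)))) n = ∀ p i j → decodeMorphism n p i j ≡ φ p i j
  code (suc (suc (suc (suc (suc zero))))) n = ∀ p → decodeFin n p ≡ τ p
  codes : ∀ i → ∃ (code i)
  codes zero = m , refl
  codes (suc zero) = t₁ , refl
  codes (suc (suc zero)) = t₂ , refl
  codes (suc (suc (suc zero))) = toℕ a , toℕ-mod a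
  codes (suc (suc (suc (suc zero)))) = decodeMorphism-surjective φ
  codes (suc (suc (suc (suc (suc zero))))) = decodeFin-surjective τ
  c : ℕ
  c = proj₁ (decode-choice 6 code codes)
  entries : ∀ i → code i (decode c (toℕ i))
  entries = proj₂ (decode-choice 6 code codes)
  shape : ∀ i j → enumMorphic c i j ≡ morphicWord m t₁ t₂ (decode c 3) (decode c 4) (decode c 5) i j
  shape = enumMorphic-decode c (entries (# 0)) (entries (# 1)) (entries (# 2))
  limit : ∀ i j → morphicWord m t₁ t₂ (decode c 3) (decode c 4) (decode c 5) i j ≡ τ (x i j)
  limit = morphicWord-limit {a = decode c 3} {decode c 4} {decode c 5} (entries (# 3)) (entries (# 4)) (entries (# 5)) lim

module Diagonal {k : ℕ} (f : ℕ → Word (Fin (2 + k))) where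

  letter : ℕ → ℕ → ℕ → Fin (2 + k)
  letter (suc (suc n)) x zero = punchIn (f n x 0) zero
  letter (suc (suc n)) x (suc zero) = punchIn (enumMorphic n x 1) zero
  letter _ _ _ = zero

  open Filling letter public

  fill-edge : ∀ n y → y ≤ 1 → fill (edge n) y ≡ letter (2 + n) (edge n) y
  fill-edge n y y≤1 = fill-InS (edge-InS n (≤-<-trans y≤1 (<-trans (s≤s (s≤s z≤n)) (n<region (2 + n)))))

  fill-differs : ∀ n → fill (edge n) 0 ≢ f n (edge n) 0
  fill-differs n fill≡f = punchInᵢ≢i (f n (edge n) 0) zero (trans (sym (fill-edge n 0 z≤n)) fill≡f)

  fill-not-morphic : ¬ IsMorphic fill
  fill-not-morphic morphic with c , fill≡ ← enumMorphic-complete morphic =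
    punchInᵢ≢i (enumMorphic c (edge c) 1) zero (trans (sym (fill-edge c 1 ≤-refl)) (fill≡ (edge c) 1))

proposition7p2 : (k : ℕ) → 2 ≤ k → (f : ℕ → Word (Fin k)) →
    Σ[ w ∈ Word (Fin k) ] Constructible w × ¬ IsMorphic w ×
      (∀ n → ∃ λ i → ∃ λ j → w i j ≢ f n i j)
proposition7p2 (suc (suc k)) (s≤s (s≤s z≤n)) f =
  fill , fill-constructible , fill-not-morphic , λ n → edge n , 0 , fill-differs n
  where open Diagonal f
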